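{- For every positive integer $q$ and every $\varepsilon\in(0,1]$ such that $q^\varepsilon$ is an integer, there is a zeroing out of $\langle q,q^\varepsilon,q\rangle^{\otimes n}$ into $q^{(1+\varepsilon)n-o(n)}$ independent triples (as $n\to\infty$).
   Context: $\langle a,b,c\rangle=\sum_{i=1}^a\sum_{j=1}^b\sum_{k=1}^c x_{ij}y_{jk}z_{ki}$ is the matrix multiplication tensor, and $A^{\otimes n}$ is the $n$-th tensor (Kronecker) power. A tensor $A$ over $X,Y,Z$ is a zeroing out of $B$ if $A$ is obtained from $B$ by setting some variables to zero, i.e. each $A_{ijk}\in\{B_{ijk},0\}$ and there are functions $a:X\to\mathbb Z_{\ge0}$, $b:Y\to\mathbb Z_{\ge0}$, $c:Z\to\mathbb Z_{\ge0}$ with $A_{ijk}\ne0$ iff ($B_{ijk}\neq0$ and $a(x_i)+b(y_j)+c(z_k)=0$). A tensor is independent if any two distinct terms $x_iy_jz_k$, $x_{i'}y_{j'}z_{k'}$ with nonzero coefficients have $x_i\ne x_{i'}$, $y_j\ne y_{j'}$, $z_k\ne z_{k'}$. "Zeroing out into $m$ independent triples" means a zeroing out which is an independent tensor with $m$ nonzero terms. -}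

module Defs where

open import Data.Nat using (ℕ; zero; suc; _+_; _*_)
open import Data.Nat.Properties using (_≟_)
open import Data.Fin using (Fin)
open import Data.Fin.Properties renaming (_≟_ to _≟ᶠ_)
open import Data.Vec using (Vec; []; _∷_)
open import Data.Product using (Σ; ∃; _×_; _,_; proj₁; proj₂)
open import Relation.Nullary using (¬_; yes; no)
open import Relation.Binary.PropositionalEquality using (_≡_; _≢_)

-- A tensor over variable sets X, Y, Z: its coefficient of x y z.
-- (Coefficients in ℕ suffice: all tensors here have 0/1 coefficients.)
Tensor : Set → Set → Set → Set
Tensor X Y Z = X → Y → Z → ℕ

δ : ∀ {k} → Fin k → Fin k → ℕ
δ i i' with i ≟ᶠ i'
... | yes _ = 1
... | no  _ = 0

-- ⟨a,b,c⟩ = Σ_{i,j,k} x_{ij} y_{jk} z_{ki};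
-- x-variables indexed by Fin a × Fin b, y by Fin b × Fin c, z by Fin c × Fin a.
MM : (a b c : ℕ) → Tensor (Fin a × Fin b) (Fin b × Fin c) (Fin c × Fin a)
MM a b c (i , j) (j' , k) (k' , i') = δ j j' * δ k k' * δ i i'

_⊗^_ : ∀ {X Y Z} → Tensor X Y Z → (n : ℕ) → Tensor (Vec X n) (Vec Y n) (Vec Z n)
(T ⊗^ zero) [] [] [] = 1
(T ⊗^ suc n) (x ∷ xs) (y ∷ ys) (z ∷ zs) = T x y z * (T ⊗^ n) xs ys zs

zeroOut : ∀ {X Y Z} → Tensor X Y Z → (X → ℕ) → (Y → ℕ) → (Z → ℕ) → Tensor X Y Z
zeroOut T α β γ x y z with α x + β y + γ z ≟ 0
... | yes _ = T x y z
... | no  _ = 0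

-- A is an independent tensor with exactly m nonzero terms:
-- its nonzero terms are enumerated bijectively by Fin m (t hits every
-- nonzero term, only nonzero terms, and distinct indices give terms with
-- pairwise distinct x-, y- and z-variables, hence t is injective).
IndependentWith : ∀ {X Y Z} → Tensor X Y Z → ℕ → Set
IndependentWith {X} {Y} {Z} A m =
  Σ (Fin m → X × Y × Z) λ t →
      (∀ l → let (x , y , z) = t l in A x y z ≢ 0)
    × (∀ x y z → A x y z ≢ 0 → ∃ λ l → t l ≡ (x , y , z))
    × (∀ l l' → l ≢ l' →
         let (x , y , z) = t l ; (x' , y' , z') = t l' in
         x ≢ x' × y ≢ y' × z ≢ z')

ZeroesOutInto : ∀ {X Y Z} → Tensor X Y Z → ℕ → Set
ZeroesOutInto {X} {Y} {Z} T m =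
  Σ (X → ℕ) λ α → Σ (Y → ℕ) λ β → Σ (Z → ℕ) λ γ →
    IndependentWith (zeroOut T α β γ) m

-- With r = q^ε the o(n) is made explicit: for all a, b and all
-- large n there are m triples with m^(b+1) q^((a+1)n) ≥ (qr)^((b+1)n).
--
-- Zeroings out are transported along isomorphisms of tensors and
-- multiply under tensor products; since ⟨q,r,q⟩^(N T) ≅ ⟨q^T,r^T,q^T⟩^N,
-- it suffices to zero out powers of ⟨Q,R,Q⟩ well.  There we use a
-- Behrend-type construction: the box terms x_{i,j} y_{j,i+j} z_{i+j,i}
-- (i < Q₁, j < R₁) get equal weights while every term x_{ij} y_{jk} z_{ki}
-- has weights in arithmetic progression; keeping the variables whose
-- weight vectors lie on a fixed sphere leaves only box terms (a sphere has
-- no three-term progressions), and by pigeonhole some sphere carries a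
-- 1/(1 + N(4Q)²) fraction of all (Q₁R₁)^N box tuples.  Choosing
-- Q = q^(t+1), Q₁ = q^t, R₁ = r^t, a single triple on the remaining
-- coordinates, and blocks of length 8(b+1), the total loss is q^(o(n)).
module Submission where

open import Defs
open import Data.Nat using (ℕ; zero; suc; _+_; _*_; _^_; _∸_; ∣_-_∣; _≤_; _<_; _≥_; z≤n; s≤s; NonZero; >-nonZero)
open import Data.Nat.Properties using
  ( _≟_; _≤?_; _<?_; module ≤-Reasoning
  ; ≤-refl; ≤-trans; ≤-reflexive; ≤-total; ≤-pred; <⇒≤; <⇒≢; ≰⇒>; ≤∧≢⇒<; <-≤-trans
  ; +-comm; +-suc; +-identityʳ; +-cancelˡ-≡; +-cancelʳ-≡; +-mono-≤; +-monoˡ-≤; +-monoʳ-≤; +-mono-<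
  ; *-comm; *-assoc; *-identityˡ; *-zeroʳ; *-cancelˡ-≡; *-mono-≤; *-monoˡ-≤; *-monoʳ-≤
  ; m≤m+n; m≤n+m; m≤n*m; m+n∸m≡n; m+[n∸m]≡n; m+n≡0⇒m≡0; m+n≡0⇒n≡0; m*n≡0⇒m≡0∨n≡0; 1+n≢0
  ; ∣m-n∣≡0⇒m≡n; ∣-∣-comm
  ; ^-zeroˡ; ^-distribˡ-+-*; ^-*-assoc; ^-monoˡ-≤; ^-monoʳ-≤; m^n>0 )
open import Data.Nat.DivMod using (_/_; _%_; m≡m%n+[m/n]*n; m%n<n; m*n/n≡m; /-monoˡ-≤)
open import Data.Nat.Tactic.RingSolver using (solve-∀)
open import Data.Fin using (Fin; zero; suc; combine; remQuot; toℕ; fromℕ<; inject≤)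
open import Data.Fin.Properties
  using (*↔×; toℕ-injective; toℕ<n; toℕ-fromℕ<; toℕ-inject≤; inject≤-injective
        ; remQuot-combine; combine-remQuot; combine-injectiveˡ; combine-injectiveʳ)
  renaming (_≟_ to _≟ᶠ_)
open import Data.Product using (Σ; ∃; _×_; _,_; proj₁; proj₂; uncurry)
open import Data.Product.Properties using (,-injectiveˡ; ,-injectiveʳ)
import Data.Product.Properties as Product
open import Data.Product.Function.NonDependent.Propositional using (_×-↔_)
open import Data.Sum using ([_,_]; inj₁; inj₂; reduce)
open import Data.Empty using (⊥-elim)
open import Data.Vec using (Vec; []; _∷_; _++_; take; drop; concat; group; map; replicate)
open import Data.Vec.Properties using (×v↔v×; ∷-injective; take++drop≡id; ++-injective; map-∘; map-cong; map-id)
import Data.Vec.Properties as Vec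
import Data.Vec.Relation.Unary.All as VecAll
import Data.Vec.Relation.Unary.All.Properties as VecAll
open import Data.List using (List; []; _∷_; length; lookup; filter; allFin)
import Data.List as List
import Data.List.Properties as ListP
open import Data.List.Membership.Propositional using (_∈_)
open import Data.List.Membership.Propositional.Properties using (∈-lookup; ∈-allFin; ∈-map⁺; ∈-map⁻; ∈-filter⁺; ∈-filter⁻)
open import Data.List.Relation.Unary.Any using (here; there; index)
open import Data.List.Relation.Unary.Any.Properties using (lookup-index)
import Data.List.Relation.Unary.All as All
open import Data.List.Relation.Unary.AllPairs using (AllPairs; []; _∷_)
import Data.List.Relation.Unary.AllPairs as AllPairs
import Data.List.Relation.Unary.AllPairs.Properties as AllPairs
open import Data.List.Relation.Unary.Unique.Propositional using (Unique)
import Data.List.Relation.Unary.Unique.Propositional.Properties as Unique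
open import Function using (_∘_)
open import Function.Bundles using (_↔_; Inverse; mk↔ₛ′)
open import Function.Properties.Inverse using (↔-refl; ↔-sym; ↔-trans)
open import Relation.Nullary using (Dec; yes; no)
open import Relation.Nullary.Decidable using (_×-dec_)
open import Relation.Binary.Definitions using (DecidableEquality)
open import Relation.Binary.PropositionalEquality using (_≡_; _≢_; refl; sym; trans; cong; cong₂; subst; module ≡-Reasoning)

open Inverse using (to; from; strictlyInverseˡ; strictlyInverseʳ)

Term : Set → Set → Set → Set
Term X Y Z = X × Y × Z

infix 6 _at_
_at_ : ∀ {X Y Z} → Tensor X Y Z → Term X Y Z → ℕ
A at (x , y , z) = A x y z

Distinct : ∀ {X Y Z : Set} → Term X Y Z → Term X Y Z → Set
Distinct (x , y , z) (x′ , y′ , z′) = x ≢ x′ × y ≢ y′ × z ≢ z′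

Distinct-sym : ∀ {X Y Z : Set} {τ τ′ : Term X Y Z} → Distinct τ τ′ → Distinct τ′ τ
Distinct-sym (x≢ , y≢ , z≢) = x≢ ∘ sym , y≢ ∘ sym , z≢ ∘ sym

*-≢0 : ∀ m n → m ≢ 0 → n ≢ 0 → m * n ≢ 0
*-≢0 m n m≢0 n≢0 e = [ m≢0 , n≢0 ] (m*n≡0⇒m≡0∨n≡0 m e)

*≢0⇒ˡ : ∀ m n → m * n ≢ 0 → m ≢ 0
*≢0⇒ˡ m n mn≢0 refl = mn≢0 refl

*≢0⇒ʳ : ∀ m n → m * n ≢ 0 → n ≢ 0
*≢0⇒ʳ m n mn≢0 refl = mn≢0 (*-zeroʳ m)

-- Zeroing out keeps a coefficient c exactly when the total weight w of its
-- term is 0; all facts about zeroOut are read off from keepIf.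
keepIf : ℕ → ℕ → ℕ
keepIf zero    c = c
keepIf (suc _) c = 0

zeroOut-keepIf : ∀ {X Y Z} (T : Tensor X Y Z) α β γ x y z →
  zeroOut T α β γ x y z ≡ keepIf (α x + β y + γ z) (T x y z)
zeroOut-keepIf T α β γ x y z with α x + β y + γ z ≟ 0
... | yes w≡0 rewrite w≡0 = refl
... | no  w≢0 with α x + β y + γ z
...   | zero  = ⊥-elim (w≢0 refl)
...   | suc _ = refl

keepIf-support : ∀ w c → keepIf w c ≢ 0 → w ≡ 0 × c ≢ 0
keepIf-support zero    c c≢0 = refl , c≢0
keepIf-support (suc _) c 0≢0 = ⊥-elim (0≢0 refl)

zeroOut-support : ∀ {X Y Z} (T : Tensor X Y Z) α β γ x y z →
  zeroOut T α β γ x y z ≢ 0 → α x + β y + γ z ≡ 0 × T x y z ≢ 0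
zeroOut-support T α β γ x y z nz =
  keepIf-support _ _ (λ e → nz (trans (zeroOut-keepIf T α β γ x y z) e))

zeroOut-kept : ∀ {X Y Z} (T : Tensor X Y Z) α β γ x y z →
  α x + β y + γ z ≡ 0 → zeroOut T α β γ x y z ≡ T x y z
zeroOut-kept T α β γ x y z w≡0 =
  trans (zeroOut-keepIf T α β γ x y z) (cong (λ w → keepIf w (T x y z)) w≡0)

infix 4 _≅_
record _≅_ {X Y Z X′ Y′ Z′ : Set} (T : Tensor X Y Z) (T′ : Tensor X′ Y′ Z′) : Set where
  field
    onX : X ↔ X′
    onY : Y ↔ Y′
    onZ : Z ↔ Z′
    coefficient : ∀ x y z → T′ (to onX x) (to onY y) (to onZ z) ≡ T x y z
open _≅_

≗⇒≅ : ∀ {X Y Z} {T T′ : Tensor X Y Z} → (∀ x y z → T x y z ≡ T′ x y z) → T ≅ T′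
≗⇒≅ T≗T′ = record { onX = ↔-refl ; onY = ↔-refl ; onZ = ↔-refl
                  ; coefficient = λ x y z → sym (T≗T′ x y z) }

≅-sym : ∀ {X Y Z X′ Y′ Z′} {T : Tensor X Y Z} {T′ : Tensor X′ Y′ Z′} → T ≅ T′ → T′ ≅ T
≅-sym {T = T} {T′} i = record
  { onX = ↔-sym (onX i) ; onY = ↔-sym (onY i) ; onZ = ↔-sym (onZ i)
  ; coefficient = λ x y z → begin
      T (from (onX i) x) (from (onY i) y) (from (onZ i) z)
        ≡⟨ sym (coefficient i _ _ _) ⟩
      T′ (to (onX i) (from (onX i) x)) (to (onY i) (from (onY i) y)) (to (onZ i) (from (onZ i) z))
        ≡⟨ cong₂ (λ x′ yz → T′ x′ (proj₁ yz) (proj₂ yz)) (strictlyInverseˡ (onX i) x)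
             (cong₂ _,_ (strictlyInverseˡ (onY i) y) (strictlyInverseˡ (onZ i) z)) ⟩
      T′ x y z ∎ }
  where open ≡-Reasoning

to-injective : ∀ {A B : Set} (f : A ↔ B) {a a′} → to f a ≡ to f a′ → a ≡ a′
to-injective f {a} {a′} e =
  trans (sym (strictlyInverseʳ f a)) (trans (cong (from f) e) (strictlyInverseʳ f a′))

independent-≅ : ∀ {X Y Z X′ Y′ Z′} {A : Tensor X Y Z} {A′ : Tensor X′ Y′ Z′} {m} →
  A ≅ A′ → IndependentWith A m → IndependentWith A′ m
independent-≅ {X} {Y} {Z} {X′} {Y′} {Z′} {A} {A′} {m} i (t , nz , cov , dis) =
  relabel ∘ t , nz′ , cov′ , dis′
  where
  relabel : Term X Y Z → Term X′ Y′ Z′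
  relabel (x , y , z) = to (onX i) x , to (onY i) y , to (onZ i) z
  nz′ : ∀ l → A′ at relabel (t l) ≢ 0
  nz′ l e = nz l (trans (sym (coefficient i _ _ _)) e)
  cov′ : ∀ x y z → A′ x y z ≢ 0 → ∃ λ l → relabel (t l) ≡ (x , y , z)
  cov′ x y z a≢0 with cov (from (onX i) x) (from (onY i) y) (from (onZ i) z)
                        (λ e → a≢0 (trans (sym (coefficient (≅-sym i) x y z)) e))
  ... | l , tl≡ = l , trans (cong relabel tl≡)
        (cong₂ _,_ (strictlyInverseˡ (onX i) x)
          (cong₂ _,_ (strictlyInverseˡ (onY i) y) (strictlyInverseˡ (onZ i) z)))
  dis′ : ∀ l l′ → l ≢ l′ → Distinct (relabel (t l)) (relabel (t l′))
  dis′ l l′ l≢l′ with dis l l′ l≢l′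
  ... | x≢ , y≢ , z≢ = x≢ ∘ to-injective (onX i) , y≢ ∘ to-injective (onY i) , z≢ ∘ to-injective (onZ i)

zeroOut-≅ : ∀ {X Y Z X′ Y′ Z′} {T : Tensor X Y Z} {T′ : Tensor X′ Y′ Z′} (i : T ≅ T′) α β γ →
  zeroOut T α β γ ≅ zeroOut T′ (α ∘ from (onX i)) (β ∘ from (onY i)) (γ ∘ from (onZ i))
zeroOut-≅ {X} {Y} {Z} {X′} {Y′} {Z′} {T} {T′} i α β γ = record
  { onX = onX i ; onY = onY i ; onZ = onZ i
  ; coefficient = λ x y z → begin
      zeroOut T′ α′ β′ γ′ (to (onX i) x) (to (onY i) y) (to (onZ i) z)
        ≡⟨ zeroOut-keepIf T′ α′ β′ γ′ _ _ _ ⟩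
      keepIf (α′ (to (onX i) x) + β′ (to (onY i) y) + γ′ (to (onZ i) z)) _
        ≡⟨ cong₂ keepIf (cong₂ _+_ (cong₂ _+_ (cong α (strictlyInverseʳ (onX i) x))
                                             (cong β (strictlyInverseʳ (onY i) y)))
                                  (cong γ (strictlyInverseʳ (onZ i) z)))
                        (coefficient i x y z) ⟩
      keepIf (α x + β y + γ z) (T x y z)
        ≡⟨ sym (zeroOut-keepIf T α β γ x y z) ⟩
      zeroOut T α β γ x y z ∎ }
  where
  open ≡-Reasoning
  α′ : X′ → ℕ
  α′ = α ∘ from (onX i)
  β′ : Y′ → ℕ
  β′ = β ∘ from (onY i)
  γ′ : Z′ → ℕ
  γ′ = γ ∘ from (onZ i)

zeroesOut-≅ : ∀ {X Y Z X′ Y′ Z′} {T : Tensor X Y Z} {T′ : Tensor X′ Y′ Z′} {m} →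
  T ≅ T′ → ZeroesOutInto T m → ZeroesOutInto T′ m
zeroesOut-≅ i (α , β , γ , ind) =
  α ∘ from (onX i) , β ∘ from (onY i) , γ ∘ from (onZ i) , independent-≅ (zeroOut-≅ i α β γ) ind

infixl 7 _⊠_
_⊠_ : ∀ {X Y Z X′ Y′ Z′} → Tensor X Y Z → Tensor X′ Y′ Z′ → Tensor (X × X′) (Y × Y′) (Z × Z′)
(A ⊠ B) (x , x′) (y , y′) (z , z′) = A x y z * B x′ y′ z′

pairUp : ∀ {X Y Z X′ Y′ Z′ : Set} → Term X Y Z → Term X′ Y′ Z′ → Term (X × X′) (Y × Y′) (Z × Z′)
pairUp (x , y , z) (x′ , y′ , z′) = (x , x′) , (y , y′) , (z , z′)

independent-⊠ : ∀ {X Y Z X′ Y′ Z′} {A : Tensor X Y Z} {B : Tensor X′ Y′ Z′} {m m′} →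
  IndependentWith A m → IndependentWith B m′ → IndependentWith (A ⊠ B) (m * m′)
independent-⊠ {X} {Y} {Z} {X′} {Y′} {Z′} {A} {B} {m} {m′} (t , nz , cov , dis) (t′ , nz′ , cov′ , dis′) =
  pairTerm ∘ remQuot {m} m′ , nz⊠ ∘ remQuot {m} m′ , cov⊠ , dis⊠
  where
  pairTerm : Fin m × Fin m′ → Term (X × X′) (Y × Y′) (Z × Z′)
  pairTerm (l , l′) = pairUp (t l) (t′ l′)
  nz⊠ : ∀ p → (A ⊠ B) at pairTerm p ≢ 0
  nz⊠ (l , l′) = *-≢0 _ _ (nz l) (nz′ l′)
  cov⊠ : ∀ x y z → (A ⊠ B) x y z ≢ 0 → ∃ λ k → pairTerm (remQuot {m} m′ k) ≡ (x , y , z)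
  cov⊠ (x , x′) (y , y′) (z , z′) ab≢0
    with cov x y z (*≢0⇒ˡ _ (B x′ y′ z′) ab≢0) | cov′ x′ y′ z′ (*≢0⇒ʳ (A x y z) _ ab≢0)
  ... | l , tl≡ | l′ , t′l′≡ =
    combine l l′ , trans (cong pairTerm (remQuot-combine l l′)) (cong₂ pairUp tl≡ t′l′≡)
  disPairs : ∀ p p′ → p ≢ p′ → Distinct (pairTerm p) (pairTerm p′)
  disPairs (l , l′) (k , k′) p≢p′ with l ≟ᶠ k
  ... | no l≢k = let (x≢ , y≢ , z≢) = dis l k l≢k in
      x≢ ∘ ,-injectiveˡ , y≢ ∘ ,-injectiveˡ , z≢ ∘ ,-injectiveˡ
  ... | yes refl = let (x≢ , y≢ , z≢) = dis′ l′ k′ (p≢p′ ∘ cong (l ,_)) in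
      x≢ ∘ ,-injectiveʳ , y≢ ∘ ,-injectiveʳ , z≢ ∘ ,-injectiveʳ
  dis⊠ : ∀ k k′ → k ≢ k′ → Distinct (pairTerm (remQuot {m} m′ k)) (pairTerm (remQuot {m} m′ k′))
  dis⊠ k k′ k≢k′ = disPairs (remQuot {m} m′ k) (remQuot {m} m′ k′)
    (λ e → k≢k′ (trans (sym (combine-remQuot {m} m′ k))
                  (trans (cong (uncurry combine) e) (combine-remQuot {m} m′ k′))))

_⊕_ : ∀ {V V′ : Set} → (V → ℕ) → (V′ → ℕ) → V × V′ → ℕ
(α ⊕ α′) (v , v′) = α v + α′ v′

-- A sum of weights vanishes exactly when both summands do.
keepIf-+ : ∀ u v c d → keepIf (u + v) (c * d) ≡ keepIf u c * keepIf v d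
keepIf-+ zero    zero    c d = refl
keepIf-+ zero    (suc v) c d = sym (*-zeroʳ c)
keepIf-+ (suc u) v       c d = refl

zeroOut-⊠ : ∀ {X Y Z X′ Y′ Z′} (A : Tensor X Y Z) (B : Tensor X′ Y′ Z′) α β γ α′ β′ γ′ x y z →
  zeroOut (A ⊠ B) (α ⊕ α′) (β ⊕ β′) (γ ⊕ γ′) x y z
    ≡ (zeroOut A α β γ ⊠ zeroOut B α′ β′ γ′) x y z
zeroOut-⊠ A B α β γ α′ β′ γ′ (x , x′) (y , y′) (z , z′) = begin
  zeroOut (A ⊠ B) (α ⊕ α′) (β ⊕ β′) (γ ⊕ γ′) (x , x′) (y , y′) (z , z′)
    ≡⟨ zeroOut-keepIf (A ⊠ B) (α ⊕ α′) (β ⊕ β′) (γ ⊕ γ′) (x , x′) (y , y′) (z , z′) ⟩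
  keepIf ((α x + α′ x′) + (β y + β′ y′) + (γ z + γ′ z′)) (A x y z * B x′ y′ z′)
    ≡⟨ cong (λ w → keepIf w (A x y z * B x′ y′ z′)) (regroup (α x) (α′ x′) (β y) (β′ y′) (γ z) (γ′ z′)) ⟩
  keepIf ((α x + β y + γ z) + (α′ x′ + β′ y′ + γ′ z′)) (A x y z * B x′ y′ z′)
    ≡⟨ keepIf-+ (α x + β y + γ z) (α′ x′ + β′ y′ + γ′ z′) (A x y z) (B x′ y′ z′) ⟩
  keepIf (α x + β y + γ z) (A x y z) * keepIf (α′ x′ + β′ y′ + γ′ z′) (B x′ y′ z′)
    ≡⟨ sym (cong₂ _*_ (zeroOut-keepIf A α β γ x y z) (zeroOut-keepIf B α′ β′ γ′ x′ y′ z′)) ⟩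
  zeroOut A α β γ x y z * zeroOut B α′ β′ γ′ x′ y′ z′ ∎
  where
  open ≡-Reasoning
  regroup : ∀ a a′ b b′ c c′ → (a + a′) + (b + b′) + (c + c′) ≡ (a + b + c) + (a′ + b′ + c′)
  regroup = solve-∀

zeroesOut-⊠ : ∀ {X Y Z X′ Y′ Z′} {A : Tensor X Y Z} {B : Tensor X′ Y′ Z′} {m m′} →
  ZeroesOutInto A m → ZeroesOutInto B m′ → ZeroesOutInto (A ⊠ B) (m * m′)
zeroesOut-⊠ {A = A} {B} (α , β , γ , ind) (α′ , β′ , γ′ , ind′) =
  α ⊕ α′ , β ⊕ β′ , γ ⊕ γ′ ,
  independent-≅ (≅-sym (≗⇒≅ (zeroOut-⊠ A B α β γ α′ β′ γ′))) (independent-⊠ ind ind′)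

allPairs-lookup : ∀ {A : Set} {R : A → A → Set} → (∀ {a b} → R a b → R b a) →
  ∀ {xs} → AllPairs R xs → ∀ i j → i ≢ j → R (lookup xs i) (lookup xs j)
allPairs-lookup R-sym (_ ∷ _)   zero    zero    i≢j = ⊥-elim (i≢j refl)
allPairs-lookup R-sym (px ∷ _)  zero    (suc j) _   = All.lookup px (∈-lookup j)
allPairs-lookup R-sym (px ∷ _)  (suc i) zero    _   = R-sym (All.lookup px (∈-lookup i))
allPairs-lookup R-sym (_ ∷ pxs) (suc i) (suc j) i≢j = allPairs-lookup R-sym pxs i j (i≢j ∘ cong suc)

independent-list : ∀ {X Y Z} (A : Tensor X Y Z) (L : List (Term X Y Z)) →
  (∀ {τ} → τ ∈ L → A at τ ≢ 0) → (∀ x y z → A x y z ≢ 0 → (x , y , z) ∈ L) →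
  AllPairs Distinct L → IndependentWith A (length L)
independent-list A L listed complete distinct =
    lookup L
  , (λ l → listed (∈-lookup l))
  , (λ x y z a≢0 → let τ∈L = complete x y z a≢0 in index τ∈L , sym (lookup-index τ∈L))
  , allPairs-lookup Distinct-sym distinct

-- 1 unless the decided proposition holds: a weight vanishing exactly on
-- the chosen variable.
miss : ∀ {P : Set} → Dec P → ℕ
miss (yes _) = 0
miss (no _)  = 1

miss-yes : ∀ {P : Set} (d : Dec P) → P → miss d ≡ 0
miss-yes (yes _) _ = refl
miss-yes (no ¬p) p = ⊥-elim (¬p p)

miss≡0 : ∀ {P : Set} (d : Dec P) → miss d ≡ 0 → P
miss≡0 (yes p) _ = p

zeroesOut-single : ∀ {X Y Z} (T : Tensor X Y Z) →
  DecidableEquality X → DecidableEquality Y → DecidableEquality Z →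
  ∀ x₀ y₀ z₀ → T x₀ y₀ z₀ ≢ 0 → ZeroesOutInto T 1
zeroesOut-single {X} {Y} {Z} T _≟X_ _≟Y_ _≟Z_ x₀ y₀ z₀ T≢0 =
  α , β , γ , independent-list (zeroOut T α β γ) ((x₀ , y₀ , z₀) ∷ []) kept only (All.[] ∷ [])
  where
  α : X → ℕ
  α x = miss (x ≟X x₀)
  β : Y → ℕ
  β y = miss (y ≟Y y₀)
  γ : Z → ℕ
  γ z = miss (z ≟Z z₀)
  kept : ∀ {τ} → τ ∈ (x₀ , y₀ , z₀) ∷ [] → zeroOut T α β γ at τ ≢ 0
  kept (here refl) e = T≢0 (trans (sym (zeroOut-kept T α β γ x₀ y₀ z₀ weight₀)) e)
    where
    weight₀ : α x₀ + β y₀ + γ z₀ ≡ 0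
    weight₀ = cong₂ _+_ (cong₂ _+_ (miss-yes (x₀ ≟X x₀) refl) (miss-yes (y₀ ≟Y y₀) refl))
                        (miss-yes (z₀ ≟Z z₀) refl)
  only : ∀ x y z → zeroOut T α β γ x y z ≢ 0 → (x , y , z) ∈ (x₀ , y₀ , z₀) ∷ []
  only x y z nz with proj₁ (zeroOut-support T α β γ x y z nz)
  ... | w≡0 with miss≡0 (x ≟X x₀) (m+n≡0⇒m≡0 _ (m+n≡0⇒m≡0 _ w≡0))
               | miss≡0 (y ≟Y y₀) (m+n≡0⇒n≡0 (α x) (m+n≡0⇒m≡0 _ w≡0))
               | miss≡0 (z ≟Z z₀) (m+n≡0⇒n≡0 (α x + β y) w≡0)
  ...   | refl | refl | refl = here refl

++↔ : ∀ {A : Set} a {b} → (Vec A a × Vec A b) ↔ Vec A (a + b)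
++↔ a = mk↔ₛ′ (uncurry _++_) (λ v → take a v , drop a v) (take++drop≡id a) split-++
  where
  split-++ : ∀ {A : Set} {b} (p : Vec A a × Vec A b) → (take a (uncurry _++_ p) , drop a (uncurry _++_ p)) ≡ p
  split-++ (xs , ys) = let (e₁ , e₂) = ++-injective _ xs (take++drop≡id a (xs ++ ys)) in cong₂ _,_ e₁ e₂

concat-injective : ∀ {A : Set} {t N} (u v : Vec (Vec A t) N) → concat u ≡ concat v → u ≡ v
concat-injective []      []      _ = refl
concat-injective (x ∷ u) (y ∷ v) e =
  let (x≡y , rest) = ++-injective x y e in cong₂ _∷_ x≡y (concat-injective u v rest)

concat↔ : ∀ {A : Set} t N → Vec (Vec A t) N ↔ Vec A (N * t)
concat↔ t N = mk↔ₛ′ concat (λ v → proj₁ (group N t v)) (λ v → sym (proj₂ (group N t v)))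
  (λ u → concat-injective _ u (sym (proj₂ (group N t (concat u)))))

map↔ : ∀ {A B : Set} N → A ↔ B → Vec A N ↔ Vec B N
map↔ N f = mk↔ₛ′ (map (to f)) (map (from f))
  (λ v → trans (sym (map-∘ _ _ v)) (trans (map-cong (strictlyInverseˡ f) v) (map-id v)))
  (λ v → trans (sym (map-∘ _ _ v)) (trans (map-cong (strictlyInverseʳ f) v) (map-id v)))

⊗^-++ : ∀ {X Y Z} (T : Tensor X Y Z) {a b} (xs : Vec X a) ys zs (xs′ : Vec X b) ys′ zs′ →
  (T ⊗^ (a + b)) (xs ++ xs′) (ys ++ ys′) (zs ++ zs′) ≡ (T ⊗^ a) xs ys zs * (T ⊗^ b) xs′ ys′ zs′
⊗^-++ T []       []       []       xs′ ys′ zs′ = sym (*-identityˡ _)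
⊗^-++ T (x ∷ xs) (y ∷ ys) (z ∷ zs) xs′ ys′ zs′ =
  trans (cong (T x y z *_) (⊗^-++ T xs ys zs xs′ ys′ zs′)) (sym (*-assoc (T x y z) _ _))

⊗^-+ : ∀ {X Y Z} (T : Tensor X Y Z) a b → (T ⊗^ a) ⊠ (T ⊗^ b) ≅ T ⊗^ (a + b)
⊗^-+ T a b = record
  { onX = ++↔ a ; onY = ++↔ a ; onZ = ++↔ a
  ; coefficient = λ { (xs , xs′) (ys , ys′) (zs , zs′) → ⊗^-++ T xs ys zs xs′ ys′ zs′ } }

⊗^-concat : ∀ {X Y Z} (T : Tensor X Y Z) t N → (T ⊗^ t) ⊗^ N ≅ T ⊗^ (N * t)
⊗^-concat T t N = record
  { onX = concat↔ t N ; onY = concat↔ t N ; onZ = concat↔ t N ; coefficient = blocks }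
  where
  blocks : ∀ {N} xs ys zs → (T ⊗^ (N * t)) (concat xs) (concat ys) (concat zs) ≡ ((T ⊗^ t) ⊗^ N) xs ys zs
  blocks []       []       []       = refl
  blocks (x ∷ xs) (y ∷ ys) (z ∷ zs) =
    trans (⊗^-++ T x y z _ _ _) (cong ((T ⊗^ t) x y z *_) (blocks xs ys zs))

⊗^-cong : ∀ {X Y Z X′ Y′ Z′} {T : Tensor X Y Z} {T′ : Tensor X′ Y′ Z′} N → T ≅ T′ → T ⊗^ N ≅ T′ ⊗^ N
⊗^-cong {T = T} {T′} N i = record
  { onX = map↔ N (onX i) ; onY = map↔ N (onY i) ; onZ = map↔ N (onZ i) ; coefficient = coordinatewise }
  where
  coordinatewise : ∀ {N} xs ys zs →
    (T′ ⊗^ N) (map (to (onX i)) xs) (map (to (onY i)) ys) (map (to (onZ i)) zs) ≡ (T ⊗^ N) xs ys zs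
  coordinatewise []       []       []       = refl
  coordinatewise (x ∷ xs) (y ∷ ys) (z ∷ zs) = cong₂ _*_ (coefficient i x y z) (coordinatewise xs ys zs)

zeroesOut-⊗^-+ : ∀ {X Y Z} (T : Tensor X Y Z) a b {m m′} →
  ZeroesOutInto (T ⊗^ a) m → ZeroesOutInto (T ⊗^ b) m′ → ZeroesOutInto (T ⊗^ (a + b)) (m * m′)
zeroesOut-⊗^-+ T a b zoa zob = zeroesOut-≅ (⊗^-+ T a b) (zeroesOut-⊠ zoa zob)

δ-≡ : ∀ {k} {i j : Fin k} → i ≡ j → δ i j ≡ 1
δ-≡ {i = i} refl with i ≟ᶠ i
... | yes _ = refl
... | no i≢i = ⊥-elim (i≢i refl)

δ-≢ : ∀ {k} {i j : Fin k} → i ≢ j → δ i j ≡ 0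
δ-≢ {i = i} {j} i≢j with i ≟ᶠ j
... | yes i≡j = ⊥-elim (i≢j i≡j)
... | no _ = refl

δ≢0 : ∀ {k} {i j : Fin k} → δ i j ≢ 0 → i ≡ j
δ≢0 {i = i} {j} δ≢ with i ≟ᶠ j
... | yes i≡j = i≡j
... | no _    = ⊥-elim (δ≢ refl)

δ-combine : ∀ {m n} (i j : Fin m) (e e′ : Fin n) → δ (combine i e) (combine j e′) ≡ δ i j * δ e e′
δ-combine i j e e′ = byCases (i ≟ᶠ j) (e ≟ᶠ e′)
  where
  byCases : Dec (i ≡ j) → Dec (e ≡ e′) → δ (combine i e) (combine j e′) ≡ δ i j * δ e e′
  byCases (yes i≡j) (yes e≡e′) =
    trans (δ-≡ (cong₂ combine i≡j e≡e′)) (sym (cong₂ _*_ (δ-≡ i≡j) (δ-≡ e≡e′)))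
  byCases (no i≢j) _ =
    trans (δ-≢ (i≢j ∘ combine-injectiveˡ i e j e′)) (sym (cong (_* δ e e′) (δ-≢ i≢j)))
  byCases (yes _) (no e≢e′) =
    trans (δ-≢ (e≢e′ ∘ combine-injectiveʳ i e j e′)) (sym (trans (cong (δ i j *_) (δ-≢ e≢e′)) (*-zeroʳ (δ i j))))

encode : ∀ {a t} → Vec (Fin a) t → Fin (a ^ t)
encode []      = zero
encode (i ∷ v) = combine i (encode v)

decode : ∀ {a} t → Fin (a ^ t) → Vec (Fin a) t
decode zero    _ = []
decode {a} (suc t) f = let (i , g) = remQuot {a} (a ^ t) f in i ∷ decode t g

digits↔ : ∀ a t → Vec (Fin a) t ↔ Fin (a ^ t)
digits↔ a t = mk↔ₛ′ encode (decode t) (encode-decode t) decode-encode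
  where
  encode-decode : ∀ t (f : Fin (a ^ t)) → encode (decode t f) ≡ f
  encode-decode zero    zero = refl
  encode-decode (suc t) f =
    trans (cong (combine {a} (proj₁ (remQuot {a} (a ^ t) f))) (encode-decode t _)) (combine-remQuot {a} (a ^ t) f)
  decode-encode : ∀ {t} (v : Vec (Fin a) t) → decode t (encode v) ≡ v
  decode-encode []            = refl
  decode-encode {suc t} (i ∷ v) =
    cong₂ _∷_ (cong proj₁ split) (trans (cong (decode t ∘ proj₂) split) (decode-encode v))
    where
    split : remQuot {a} (a ^ t) (combine i (encode v)) ≡ (i , encode v)
    split = remQuot-combine {a} {a ^ t} i (encode v)

pairDigits↔ : ∀ a b t → Vec (Fin a × Fin b) t ↔ (Fin (a ^ t) × Fin (b ^ t))
pairDigits↔ a b t = ↔-trans (↔-sym ×v↔v×) (digits↔ a t ×-↔ digits↔ b t)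

MM-⊗^ : ∀ a b c t → MM a b c ⊗^ t ≅ MM (a ^ t) (b ^ t) (c ^ t)
MM-⊗^ a b c t = record
  { onX = pairDigits↔ a b t ; onY = pairDigits↔ b c t ; onZ = pairDigits↔ c a t ; coefficient = digitwise }
  where
  digitwise : ∀ {t} x y z → MM (a ^ t) (b ^ t) (c ^ t) (to (pairDigits↔ a b t) x) (to (pairDigits↔ b c t) y)
                                                      (to (pairDigits↔ c a t) z)
                          ≡ (MM a b c ⊗^ t) x y z
  digitwise [] [] [] = refl
  digitwise {suc t} ((i , j) ∷ x) ((j′ , k) ∷ y) ((k′ , i′) ∷ z) = begin
    δ (combine j J) (combine j′ J′) * δ (combine k K) (combine k′ K′) * δ (combine i I) (combine i′ I′)
      ≡⟨ cong₂ _*_ (cong₂ _*_ (δ-combine j j′ J J′) (δ-combine k k′ K K′)) (δ-combine i i′ I I′) ⟩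
    (δ j j′ * δ J J′) * (δ k k′ * δ K K′) * (δ i i′ * δ I I′)
      ≡⟨ interleave (δ j j′) (δ J J′) (δ k k′) (δ K K′) (δ i i′) (δ I I′) ⟩
    δ j j′ * δ k k′ * δ i i′ * (δ J J′ * δ K K′ * δ I I′)
      ≡⟨ cong (δ j j′ * δ k k′ * δ i i′ *_) (digitwise x y z) ⟩
    δ j j′ * δ k k′ * δ i i′ * (MM a b c ⊗^ t) x y z ∎
    where
    open ≡-Reasoning
    I I′ : Fin (a ^ t)
    J J′ : Fin (b ^ t)
    K K′ : Fin (c ^ t)
    I = proj₁ (to (pairDigits↔ a b t) x)
    J = proj₂ (to (pairDigits↔ a b t) x)
    J′ = proj₁ (to (pairDigits↔ b c t) y)
    K = proj₂ (to (pairDigits↔ b c t) y)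
    K′ = proj₁ (to (pairDigits↔ c a t) z)
    I′ = proj₂ (to (pairDigits↔ c a t) z)
    interleave : ∀ p P q Q r R → (p * P) * (q * Q) * (r * R) ≡ p * q * r * (P * Q * R)
    interleave = solve-∀

zeroesOut-blocks : ∀ q r t N {m} →
  ZeroesOutInto (MM (q ^ t) (r ^ t) (q ^ t) ⊗^ N) m → ZeroesOutInto (MM q r q ⊗^ (N * t)) m
zeroesOut-blocks q r t N zo =
  zeroesOut-≅ (⊗^-concat (MM q r q) t N) (zeroesOut-≅ (⊗^-cong N (≅-sym (MM-⊗^ q r q t))) zo)

-- A term x_ij y_jk z_ki of ⟨a,b,c⟩ is named by its index triple (i, j, k);
-- a term of the N-th power by a tuple of index triples.
Corner : ℕ → ℕ → ℕ → Set
Corner a b c = Fin a × Fin b × Fin c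

xOf : ∀ {a b c} → Corner a b c → Fin a × Fin b
xOf (i , j , k) = i , j

yOf : ∀ {a b c} → Corner a b c → Fin b × Fin c
yOf (i , j , k) = j , k

zOf : ∀ {a b c} → Corner a b c → Fin c × Fin a
zOf (i , j , k) = k , i

mmTerms : ∀ {a b c N} → Vec (Corner a b c) N →
  Term (Vec (Fin a × Fin b) N) (Vec (Fin b × Fin c) N) (Vec (Fin c × Fin a) N)
mmTerms w = map xOf w , map yOf w , map zOf w

MM⊗^-mmTerms : ∀ {a b c N} (w : Vec (Corner a b c) N) → MM a b c ⊗^ N at mmTerms w ≡ 1
MM⊗^-mmTerms []              = refl
MM⊗^-mmTerms ((i , j , k) ∷ w) =
  cong₂ _*_ (cong₂ _*_ (cong₂ _*_ (δ-≡ {i = j} refl) (δ-≡ {i = k} refl)) (δ-≡ {i = i} refl)) (MM⊗^-mmTerms w)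

MM≢0 : ∀ {a b c} (i : Fin a) (j j′ : Fin b) (k k′ : Fin c) (i′ : Fin a) →
  MM a b c (i , j) (j′ , k) (k′ , i′) ≢ 0 → j ≡ j′ × k ≡ k′ × i ≡ i′
MM≢0 i j j′ k k′ i′ nz =
    δ≢0 (*≢0⇒ˡ (δ j j′) (δ k k′) jk≢0) , δ≢0 (*≢0⇒ʳ (δ j j′) (δ k k′) jk≢0) , δ≢0 (*≢0⇒ʳ (δ j j′ * δ k k′) (δ i i′) nz)
  where
  jk≢0 : δ j j′ * δ k k′ ≢ 0
  jk≢0 = *≢0⇒ˡ (δ j j′ * δ k k′) (δ i i′) nz

MM⊗^-support : ∀ {a b c N} x y z → (MM a b c ⊗^ N) x y z ≢ 0 →
  ∃ λ (w : Vec (Corner a b c) N) → mmTerms w ≡ (x , y , z)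
MM⊗^-support [] [] [] _ = [] , refl
MM⊗^-support ((i , j) ∷ x) ((j′ , k) ∷ y) ((k′ , i′) ∷ z) nz
  with MM≢0 i j j′ k k′ i′ (*≢0⇒ˡ _ _ nz) | MM⊗^-support x y z (*≢0⇒ʳ (MM _ _ _ (i , j) (j′ , k) (k′ , i′)) _ nz)
... | refl , refl , refl | w , refl = (i , j , k) ∷ w , refl

∣m-m+n∣≡n : ∀ m n → ∣ m - m + n ∣ ≡ n
∣m-m+n∣≡n zero    n = refl
∣m-m+n∣≡n (suc m) n = ∣m-m+n∣≡n m n

Parallelogram : ℕ → ℕ → Set
Parallelogram a c = 2 * (a * a) + 2 * (c * c) ≡ (a + c) * (a + c) + ∣ a - c ∣ * ∣ a - c ∣

-- For a ≤ c write c = a + d; the law is then a ring identity.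
parallelogram-≤ : ∀ {a c} → a ≤ c → Parallelogram a c
parallelogram-≤ {a} {c} a≤c = subst (Parallelogram a) (m+[n∸m]≡n a≤c) (shifted (c ∸ a))
  where
  law : ∀ a d → 2 * (a * a) + 2 * ((a + d) * (a + d)) ≡ (a + (a + d)) * (a + (a + d)) + d * d
  law = solve-∀
  shifted : ∀ d → Parallelogram a (a + d)
  shifted d rewrite ∣m-m+n∣≡n a d = law a d

parallelogram : ∀ a c → Parallelogram a c
parallelogram a c with ≤-total a c
... | inj₁ a≤c = parallelogram-≤ a≤c
... | inj₂ c≤a = swap (parallelogram-≤ c≤a)
  where
  swap : Parallelogram c a → Parallelogram a c
  swap e = trans (+-comm (2 * (a * a)) _)
    (trans e (cong₂ _+_ (cong (λ s → s * s) (+-comm c a)) (cong (λ d → d * d) (∣-∣-comm c a))))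

sumSq : ∀ {W : Set} {N} → (W → ℕ) → Vec W N → ℕ
sumSq f []      = 0
sumSq f (e ∷ w) = f e * f e + sumSq f w

sumSq-map : ∀ {V W : Set} (f : W → ℕ) (g : V → W) {N} (v : Vec V N) → sumSq f (map g v) ≡ sumSq (f ∘ g) v
sumSq-map f g []      = refl
sumSq-map f g (e ∷ v) = cong (f (g e) * f (g e) +_) (sumSq-map f g v)

sumSq-cong : ∀ {W : Set} {f g : W → ℕ} → (∀ e → f e ≡ g e) → ∀ {N} (w : Vec W N) → sumSq f w ≡ sumSq g w
sumSq-cong f≗g []      = refl
sumSq-cong f≗g (e ∷ w) = cong₂ (λ u s → u * u + s) (f≗g e) (sumSq-cong f≗g w)

sphere : ∀ {W : Set} (a b c : W → ℕ) → (∀ e → a e + c e ≡ 2 * b e) →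
  ∀ {N} (w : Vec W N) → sumSq a w ≡ sumSq b w → sumSq c w ≡ sumSq b w → VecAll.All (λ e → a e ≡ c e) w
sphere {W} a b c a+c≡2b w ‖a‖≡‖b‖ ‖c‖≡‖b‖ = gap≡0⇒equal w (+-cancelˡ-≡ (4 * sumSq b w) _ _ (begin
    4 * sumSq b w + sumSq gap w     ≡⟨ sym (norms w) ⟩
    2 * sumSq a w + 2 * sumSq c w   ≡⟨ cong₂ (λ u v → 2 * u + 2 * v) ‖a‖≡‖b‖ ‖c‖≡‖b‖ ⟩
    2 * sumSq b w + 2 * sumSq b w   ≡⟨ double (sumSq b w) ⟩
    4 * sumSq b w + 0               ∎))
  where
  open ≡-Reasoning
  gap : W → ℕ
  gap e = ∣ a e - c e ∣
  double : ∀ s → 2 * s + 2 * s ≡ 4 * s + 0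
  double = solve-∀
  step : ∀ a c b P Q → 2 * (a + P) + 2 * (c + Q) ≡ (2 * a + 2 * c) + (2 * P + 2 * Q)
  step = solve-∀
  square2 : ∀ b P G d → (2 * b) * (2 * b) + d + (4 * P + G) ≡ 4 * (b * b + P) + (d + G)
  square2 = solve-∀
  norms : ∀ {N} (w : Vec W N) → 2 * sumSq a w + 2 * sumSq c w ≡ 4 * sumSq b w + sumSq gap w
  norms []      = refl
  norms (e ∷ w) = begin
    2 * (a e * a e + sumSq a w) + 2 * (c e * c e + sumSq c w)
      ≡⟨ step (a e * a e) (c e * c e) (b e) (sumSq a w) (sumSq c w) ⟩
    (2 * (a e * a e) + 2 * (c e * c e)) + (2 * sumSq a w + 2 * sumSq c w)
      ≡⟨ cong₂ _+_ (parallelogram (a e) (c e)) (norms w) ⟩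
    ((a e + c e) * (a e + c e) + gap e * gap e) + (4 * sumSq b w + sumSq gap w)
      ≡⟨ cong (λ s → s * s + gap e * gap e + (4 * sumSq b w + sumSq gap w)) (a+c≡2b e) ⟩
    (2 * b e) * (2 * b e) + gap e * gap e + (4 * sumSq b w + sumSq gap w)
      ≡⟨ square2 (b e) (sumSq b w) (sumSq gap w) (gap e * gap e) ⟩
    4 * (b e * b e + sumSq b w) + (gap e * gap e + sumSq gap w) ∎
  gap≡0⇒equal : ∀ {N} (w : Vec W N) → sumSq gap w ≡ 0 → VecAll.All (λ e → a e ≡ c e) w
  gap≡0⇒equal []      _ = VecAll.[]
  gap≡0⇒equal (e ∷ w) ‖gap‖≡0 =
      ∣m-n∣≡0⇒m≡n (reduce (m*n≡0⇒m≡0∨n≡0 (gap e) (m+n≡0⇒m≡0 _ ‖gap‖≡0)))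
    VecAll.∷ gap≡0⇒equal w (m+n≡0⇒n≡0 (gap e * gap e) ‖gap‖≡0)

sumBelow : (ℕ → ℕ) → ℕ → ℕ
sumBelow h zero    = 0
sumBelow h (suc K) = h K + sumBelow h K

sumBelow≤max : ∀ h K → 1 ≤ K → ∃ λ c → sumBelow h K ≤ K * h c
sumBelow≤max h (suc zero)    _ = 0 , ≤-refl
sumBelow≤max h (suc (suc K)) _ with sumBelow≤max h (suc K) (s≤s z≤n)
... | c , ≤max with h (suc K) ≤? h c
...   | yes hK≤hc = c , +-mono-≤ hK≤hc ≤max
...   | no  hK≰hc = suc K , +-monoʳ-≤ (h (suc K)) (≤-trans ≤max (*-monoʳ-≤ (suc K) (<⇒≤ (≰⇒> hK≰hc))))

module _ {A : Set} (f : A → ℕ) where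

  count : List A → ℕ → ℕ
  count xs c = length (filter (λ x → f x ≟ c) xs)

  private
    count-miss : ∀ x xs K → K ≤ f x → sumBelow (count (x ∷ xs)) K ≡ sumBelow (count xs) K
    count-miss x xs zero    _      = refl
    count-miss x xs (suc K) K<fx =
      cong₂ _+_ (cong length (ListP.filter-reject (λ x → f x ≟ K) (λ fx≡K → <⇒≢ K<fx (sym fx≡K))))
                (count-miss x xs K (<⇒≤ K<fx))

    count-hit : ∀ x xs K → f x < K → sumBelow (count (x ∷ xs)) K ≡ suc (sumBelow (count xs) K)
    count-hit x xs (suc K) fx<K with f x ≟ K
    ... | yes fx≡K = cong₂ _+_ (cong length (ListP.filter-accept (λ x → f x ≟ K) fx≡K))
                               (count-miss x xs K (≤-reflexive (sym fx≡K)))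
    ... | no  fx≢K = trans (cong₂ _+_ (cong length (ListP.filter-reject (λ x → f x ≟ K) fx≢K))
                                      (count-hit x xs K (≤∧≢⇒< (≤-pred fx<K) fx≢K)))
                           (+-suc (count xs K) _)

  length≡sumBelow-count : ∀ K (xs : List A) → (∀ {x} → x ∈ xs → f x < K) → length xs ≡ sumBelow (count xs) K
  length≡sumBelow-count K [] _ = sym (none K)
    where
    none : ∀ K → sumBelow (count []) K ≡ 0
    none zero    = refl
    none (suc K) = none K
  length≡sumBelow-count K (x ∷ xs) <K =
    trans (cong suc (length≡sumBelow-count K xs (<K ∘ there))) (sym (count-hit x xs K (<K (here refl))))

  pigeonhole : ∀ K (xs : List A) → 1 ≤ K → (∀ {x} → x ∈ xs → f x < K) → ∃ λ c → length xs ≤ K * count xs c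
  pigeonhole K xs 1≤K <K =
    let (c , ≤max) = sumBelow≤max (count xs) K 1≤K in
    c , ≤-trans (≤-reflexive (length≡sumBelow-count K xs <K)) ≤max

listing : ∀ {A : Set} {M} → A ↔ Fin M → List A
listing {M = M} f = List.map (from f) (allFin M)

listing-complete : ∀ {A : Set} {M} (f : A ↔ Fin M) a → a ∈ listing f
listing-complete f a = subst (_∈ listing f) (strictlyInverseʳ f a) (∈-map⁺ (from f) (∈-allFin (to f a)))

listing-unique : ∀ {A : Set} {M} (f : A ↔ Fin M) → Unique (listing f)
listing-unique {M = M} f = Unique.map⁺ (to-injective (↔-sym f)) (Unique.allFin⁺ M)

length-listing : ∀ {A : Set} {M} (f : A ↔ Fin M) → length (listing f) ≡ M
length-listing {M = M} f = trans (ListP.length-map (from f) (allFin M)) (ListP.length-tabulate (λ i → i))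

tuples↔ : ∀ a b N → Vec (Fin a × Fin b) N ↔ Fin ((a * b) ^ N)
tuples↔ a b N = ↔-trans (map↔ N (↔-sym (*↔× {a} {b}))) (digits↔ (a * b) N)

map-injective : ∀ {A B : Set} {f : A → B} → (∀ {a a′} → f a ≡ f a′ → a ≡ a′) →
  ∀ {N} (u v : Vec A N) → map f u ≡ map f v → u ≡ v
map-injective f-inj []      []      _ = refl
map-injective f-inj (a ∷ u) (b ∷ v) e =
  let (fa≡fb , rest) = ∷-injective e in cong₂ _∷_ (f-inj fa≡fb) (map-injective f-inj u v rest)

allInImage : ∀ {A B : Set} {g : A → B} {N} (w : Vec B N) →
  VecAll.All (λ b → ∃ λ a → g a ≡ b) w → ∃ λ v → map g v ≡ w
allInImage []      VecAll.[]              = [] , refl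
allInImage (b ∷ w) ((a , refl) VecAll.∷ rest) with allInImage w rest
... | v , refl = a ∷ v , refl

-- An element e = (i, j) of the
-- box Q₁ × R₁ names the term x_{i,j} y_{j,i+j} z_{i+j,i}; the weights ax, by, cz
-- of its three variables coincide, while on every term x_{ij} y_{jk} z_{ki}
-- they satisfy ax + cz = 2 by.  Keeping only variables whose weight vectors
-- lie on one sphere (and x-variables in the box) therefore leaves, by the
-- sphere lemma, exactly the tuples of box terms on that sphere.
module Behrend (Q R Q₁ R₁ : ℕ) (Q₁+R₁≤Q : Q₁ + R₁ ≤ Q) (R₁≤R : R₁ ≤ R) where

  Box : Set
  Box = Fin Q₁ × Fin R₁

  Q₁≤Q : Q₁ ≤ Q
  Q₁≤Q = ≤-trans (m≤m+n Q₁ R₁) Q₁+R₁≤Q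

  i+j<Q : ∀ (e : Box) → toℕ (proj₁ e) + toℕ (proj₂ e) < Q
  i+j<Q (i , j) = <-≤-trans (+-mono-< (toℕ<n i) (toℕ<n j)) Q₁+R₁≤Q

  corner : Box → Corner Q R Q
  corner (i , j) = inject≤ i Q₁≤Q , inject≤ j R₁≤R , fromℕ< (i+j<Q (i , j))

  ax : Fin Q × Fin R → ℕ
  ax (i , j) = toℕ i + 2 * toℕ j + Q

  by : Fin R × Fin Q → ℕ
  by (j , k) = toℕ j + toℕ k + Q

  cz : Fin Q × Fin Q → ℕ
  cz (k , i) = 2 * toℕ k + Q ∸ toℕ i

  value : Box → ℕ
  value e = ax (xOf (corner e))

  value-ij : ∀ i j → value (i , j) ≡ toℕ i + 2 * toℕ j + Q
  value-ij i j = cong₂ (λ a b → a + 2 * b + Q) (toℕ-inject≤ i Q₁≤Q) (toℕ-inject≤ j R₁≤R)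

  toℕ-k : ∀ i j → toℕ (proj₂ (yOf (corner (i , j)))) ≡ toℕ i + toℕ j
  toℕ-k i j = toℕ-fromℕ< (i+j<Q (i , j))

  by-corner : ∀ e → by (yOf (corner e)) ≡ value e
  by-corner (i , j) = begin
    toℕ (inject≤ j R₁≤R) + toℕ (fromℕ< (i+j<Q (i , j))) + Q
      ≡⟨ cong₂ (λ b k → b + k + Q) (toℕ-inject≤ j R₁≤R) (toℕ-k i j) ⟩
    toℕ j + (toℕ i + toℕ j) + Q ≡⟨ rearrange (toℕ i) (toℕ j) Q ⟩
    toℕ i + 2 * toℕ j + Q       ≡⟨ sym (value-ij i j) ⟩
    value (i , j)               ∎
    where
    open ≡-Reasoning
    rearrange : ∀ i j Q → j + (i + j) + Q ≡ i + 2 * j + Q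
    rearrange = solve-∀

  cz-corner : ∀ e → cz (zOf (corner e)) ≡ value e
  cz-corner (i , j) = begin
    2 * toℕ (fromℕ< (i+j<Q (i , j))) + Q ∸ toℕ (inject≤ i Q₁≤Q)
      ≡⟨ cong₂ (λ k a → 2 * k + Q ∸ a) (toℕ-k i j) (toℕ-inject≤ i Q₁≤Q) ⟩
    2 * (toℕ i + toℕ j) + Q ∸ toℕ i   ≡⟨ cong (_∸ toℕ i) (rearrange (toℕ i) (toℕ j) Q) ⟩
    toℕ i + (toℕ i + 2 * toℕ j + Q) ∸ toℕ i ≡⟨ m+n∸m≡n (toℕ i) _ ⟩
    toℕ i + 2 * toℕ j + Q            ≡⟨ sym (value-ij i j) ⟩
    value (i , j)                    ∎
    where
    open ≡-Reasoning
    rearrange : ∀ i j Q → 2 * (i + j) + Q ≡ i + (i + 2 * j + Q)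
    rearrange = solve-∀

  -- the subtraction in cz is exact
  i≤2k+Q : ∀ (i k : Fin Q) → toℕ i ≤ 2 * toℕ k + Q
  i≤2k+Q i k = ≤-trans (<⇒≤ (toℕ<n i)) (m≤n+m Q (2 * toℕ k))

  progression : ∀ (c : Corner Q R Q) → ax (xOf c) + cz (zOf c) ≡ 2 * by (yOf c)
  progression (i , j , k) = begin
    toℕ i + 2 * toℕ j + Q + (2 * toℕ k + Q ∸ toℕ i) ≡⟨ regroup (toℕ i) (toℕ j) Q _ ⟩
    2 * toℕ j + Q + (toℕ i + (2 * toℕ k + Q ∸ toℕ i)) ≡⟨ cong (2 * toℕ j + Q +_) (m+[n∸m]≡n (i≤2k+Q i k)) ⟩
    2 * toℕ j + Q + (2 * toℕ k + Q)                 ≡⟨ double (toℕ j) (toℕ k) Q ⟩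
    2 * (toℕ j + toℕ k + Q)                         ∎
    where
    open ≡-Reasoning
    regroup : ∀ i j Q d → i + 2 * j + Q + d ≡ 2 * j + Q + (i + d)
    regroup = solve-∀
    double : ∀ j k Q → 2 * j + Q + (2 * k + Q) ≡ 2 * (j + k + Q)
    double = solve-∀

  InBox : Fin Q × Fin R → Set
  InBox (i , j) = toℕ i < Q₁ × toℕ j < R₁

  corner-inBox : ∀ e → InBox (xOf (corner e))
  corner-inBox (i , j) = subst (_< Q₁) (sym (toℕ-inject≤ i Q₁≤Q)) (toℕ<n i)
                       , subst (_< R₁) (sym (toℕ-inject≤ j R₁≤R)) (toℕ<n j)

  preimage : ∀ (c : Corner Q R Q) → InBox (xOf c) → ax (xOf c) ≡ cz (zOf c) → ∃ λ e → corner e ≡ c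
  preimage (i , j , k) (i<Q₁ , j<R₁) ax≡cz =
    e , cong₂ _,_ (toℕ-injective (trans (toℕ-inject≤ i′ Q₁≤Q) (toℕ-fromℕ< i<Q₁)))
          (cong₂ _,_ (toℕ-injective (trans (toℕ-inject≤ j′ R₁≤R) (toℕ-fromℕ< j<R₁)))
                     (toℕ-injective (trans (toℕ-k i′ j′) (trans (cong₂ _+_ (toℕ-fromℕ< i<Q₁) (toℕ-fromℕ< j<R₁)) i+j≡k))))
    where
    i′ : Fin Q₁
    i′ = fromℕ< i<Q₁
    j′ : Fin R₁
    j′ = fromℕ< j<R₁
    e : Box
    e = i′ , j′
    doubled : ∀ i j Q → i + (i + 2 * j + Q) ≡ 2 * (i + j) + Q
    doubled = solve-∀
    i+j≡k : toℕ i + toℕ j ≡ toℕ k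
    i+j≡k = *-cancelˡ-≡ _ _ 2 (+-cancelʳ-≡ Q _ _ (begin
      2 * (toℕ i + toℕ j) + Q           ≡⟨ sym (doubled (toℕ i) (toℕ j) Q) ⟩
      toℕ i + (toℕ i + 2 * toℕ j + Q)   ≡⟨ cong (toℕ i +_) ax≡cz ⟩
      toℕ i + (2 * toℕ k + Q ∸ toℕ i)   ≡⟨ m+[n∸m]≡n (i≤2k+Q i k) ⟩
      2 * toℕ k + Q                     ∎))
      where open ≡-Reasoning

  xOf-corner-injective : ∀ {e e′} → xOf (corner e) ≡ xOf (corner e′) → e ≡ e′
  xOf-corner-injective {i , j} {i′ , j′} x≡x′ =
    cong₂ _,_ (inject≤-injective _ _ i i′ (,-injectiveˡ x≡x′)) (inject≤-injective _ _ j j′ (,-injectiveʳ x≡x′))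

  yOf-corner-injective : ∀ {e e′} → yOf (corner e) ≡ yOf (corner e′) → e ≡ e′
  yOf-corner-injective {i , j} {i′ , j′} y≡y′ with inject≤-injective _ _ j j′ (,-injectiveˡ y≡y′)
  ... | refl = cong (_, j) (toℕ-injective (+-cancelʳ-≡ (toℕ j) _ _
                 (trans (sym (toℕ-k i j)) (trans (cong toℕ (,-injectiveʳ y≡y′)) (toℕ-k i′ j)))))

  zOf-corner-injective : ∀ {e e′} → zOf (corner e) ≡ zOf (corner e′) → e ≡ e′
  zOf-corner-injective {i , j} {i′ , j′} z≡z′ with inject≤-injective _ _ i i′ (,-injectiveʳ z≡z′)
  ... | refl = cong (i ,_) (toℕ-injective (+-cancelˡ-≡ (toℕ i) _ _
                 (trans (sym (toℕ-k i j)) (trans (cong toℕ (,-injectiveˡ z≡z′)) (toℕ-k i j′)))))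

  -- each weight is below 4Q, so norms of N-tuples are below 1 + N (4Q)²
  value≤4Q : ∀ e → value e ≤ 4 * Q
  value≤4Q (i , j) = begin
    value (i , j)         ≡⟨ value-ij i j ⟩
    toℕ i + 2 * toℕ j + Q ≤⟨ +-monoˡ-≤ Q (+-mono-≤ (<⇒≤ (<-≤-trans (toℕ<n i) Q₁≤Q))
                                                 (*-monoʳ-≤ 2 (<⇒≤ (<-≤-trans (toℕ<n j) R₁≤Q)))) ⟩
    Q + 2 * Q + Q         ≡⟨ four Q ⟩
    4 * Q                 ∎
    where
    open ≤-Reasoning
    R₁≤Q : R₁ ≤ Q
    R₁≤Q = ≤-trans (m≤n+m R₁ Q₁) Q₁+R₁≤Q
    four : ∀ Q → Q + 2 * Q + Q ≡ 4 * Q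
    four = solve-∀

  inBox? : ∀ x → Dec (InBox x)
  inBox? (i , j) = (toℕ i <? Q₁) ×-dec (toℕ j <? R₁)

  norm : ∀ {N} → Vec Box N → ℕ
  norm = sumSq value

  norm-bound : ∀ {N} (v : Vec Box N) → norm v ≤ N * (4 * Q * (4 * Q))
  norm-bound []      = z≤n
  norm-bound (e ∷ v) = +-mono-≤ (*-mono-≤ (value≤4Q e) (value≤4Q e)) (norm-bound v)

  module OnSphere (N ρ : ℕ) where

    α : Vec (Fin Q × Fin R) N → ℕ
    α x = miss (sumSq ax x ≟ ρ) + miss (VecAll.all? inBox? x)

    β : Vec (Fin R × Fin Q) N → ℕ
    β y = miss (sumSq by y ≟ ρ)

    γ : Vec (Fin Q × Fin Q) N → ℕ
    γ z = miss (sumSq cz z ≟ ρ)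

    Sphere : Tensor (Vec (Fin Q × Fin R) N) (Vec (Fin R × Fin Q) N) (Vec (Fin Q × Fin Q) N)
    Sphere = zeroOut (MM Q R Q ⊗^ N) α β γ

    boxTerms : Vec Box N → Term (Vec (Fin Q × Fin R) N) (Vec (Fin R × Fin Q) N) (Vec (Fin Q × Fin Q) N)
    boxTerms v = mmTerms (map corner v)

    ‖x‖ : ∀ (v : Vec Box N) → sumSq ax (map xOf (map corner v)) ≡ norm v
    ‖x‖ v = trans (sumSq-map ax xOf (map corner v)) (sumSq-map (ax ∘ xOf) corner v)

    ‖y‖ : ∀ (v : Vec Box N) → sumSq by (map yOf (map corner v)) ≡ norm v
    ‖y‖ v = trans (sumSq-map by yOf (map corner v))
              (trans (sumSq-map (by ∘ yOf) corner v) (sumSq-cong by-corner v))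

    ‖z‖ : ∀ (v : Vec Box N) → sumSq cz (map zOf (map corner v)) ≡ norm v
    ‖z‖ v = trans (sumSq-map cz zOf (map corner v))
              (trans (sumSq-map (cz ∘ zOf) corner v) (sumSq-cong cz-corner v))

    boxTerm-kept : ∀ v → norm v ≡ ρ → Sphere at boxTerms v ≢ 0
    boxTerm-kept v ‖v‖≡ρ e = 1+n≢0 (begin
      1                                  ≡⟨ sym (MM⊗^-mmTerms (map corner v)) ⟩
      MM Q R Q ⊗^ N at boxTerms v         ≡⟨ sym (zeroOut-kept (MM Q R Q ⊗^ N) α β γ _ _ _ weight₀) ⟩
      Sphere at boxTerms v                ≡⟨ e ⟩
      0                                  ∎)
      where
      open ≡-Reasoning
      xs : Vec (Fin Q × Fin R) N
      xs = map xOf (map corner v)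
      inBox : VecAll.All InBox xs
      inBox = VecAll.map⁺ (VecAll.map⁺ (VecAll.universal corner-inBox v))
      weight₀ : α xs + β (map yOf (map corner v)) + γ (map zOf (map corner v)) ≡ 0
      weight₀ = cong₂ _+_ (cong₂ _+_ (cong₂ _+_ (miss-yes (sumSq ax xs ≟ ρ) (trans (‖x‖ v) ‖v‖≡ρ))
                                                  (miss-yes (VecAll.all? inBox? xs) inBox))
                                     (miss-yes (_ ≟ ρ) (trans (‖y‖ v) ‖v‖≡ρ)))
                          (miss-yes (_ ≟ ρ) (trans (‖z‖ v) ‖v‖≡ρ))

    weight₀⇒onSphere : ∀ x y z → α x + β y + γ z ≡ 0 →
      sumSq ax x ≡ ρ × VecAll.All InBox x × sumSq by y ≡ ρ × sumSq cz z ≡ ρ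
    weight₀⇒onSphere x y z w≡0 =
        miss≡0 (sumSq ax x ≟ ρ) (m+n≡0⇒m≡0 _ αx≡0)
      , miss≡0 (VecAll.all? inBox? x) (m+n≡0⇒n≡0 (miss (sumSq ax x ≟ ρ)) αx≡0)
      , miss≡0 (sumSq by y ≟ ρ) (m+n≡0⇒n≡0 (α x) (m+n≡0⇒m≡0 (α x + β y) w≡0))
      , miss≡0 (sumSq cz z ≟ ρ) (m+n≡0⇒n≡0 (α x + β y) w≡0)
      where
      αx≡0 : α x ≡ 0
      αx≡0 = m+n≡0⇒m≡0 (α x) (m+n≡0⇒m≡0 (α x + β y) w≡0)

    surviving : ∀ x y z → Sphere x y z ≢ 0 → ∃ λ v → norm v ≡ ρ × boxTerms v ≡ (x , y , z)
    surviving x y z nz with zeroOut-support (MM Q R Q ⊗^ N) α β γ x y z nz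
    ... | weight₀ , mm≢0 with MM⊗^-support x y z mm≢0
    ... | w , refl with weight₀⇒onSphere (map xOf w) (map yOf w) (map zOf w) weight₀
    ... | ‖x‖≡ρ , inBox , ‖y‖≡ρ , ‖z‖≡ρ
      with allInImage w (VecAll.map (λ {c} (inB , eq) → preimage c inB eq) (VecAll.zip (VecAll.map⁻ inBox , onSphere)))
      where
      ‖y‖≡ρ′ : sumSq (by ∘ yOf) w ≡ ρ
      ‖y‖≡ρ′ = trans (sym (sumSq-map by yOf w)) ‖y‖≡ρ
      onSphere : VecAll.All (λ c → ax (xOf c) ≡ cz (zOf c)) w
      onSphere = sphere (ax ∘ xOf) (by ∘ yOf) (cz ∘ zOf) progression w
        (trans (sym (sumSq-map ax xOf w)) (trans ‖x‖≡ρ (sym ‖y‖≡ρ′)))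
        (trans (sym (sumSq-map cz zOf w)) (trans ‖z‖≡ρ (sym ‖y‖≡ρ′)))
    ... | v , refl = v , trans (sym (‖x‖ v)) ‖x‖≡ρ , refl

    boxTerms-distinct : ∀ {v v′} → v ≢ v′ → Distinct (boxTerms v) (boxTerms v′)
    boxTerms-distinct {v} {v′} v≢v′ =
        v≢v′ ∘ map-injective xOf-corner-injective v v′ ∘ fuse xOf
      , v≢v′ ∘ map-injective yOf-corner-injective v v′ ∘ fuse yOf
      , v≢v′ ∘ map-injective zOf-corner-injective v v′ ∘ fuse zOf
      where
      fuse : ∀ {A : Set} (f : Corner Q R Q → A) → map f (map corner v) ≡ map f (map corner v′) →
        map (f ∘ corner) v ≡ map (f ∘ corner) v′
      fuse f e = trans (map-∘ f corner v) (trans e (sym (map-∘ f corner v′)))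

    independent : (vs : List (Vec Box N)) → Unique vs → (∀ v → v ∈ vs) →
      IndependentWith Sphere (length (filter (λ v → norm v ≟ ρ) vs))
    independent vs unique complete =
      subst (IndependentWith Sphere) (ListP.length-map boxTerms onSphere)
        (independent-list Sphere (List.map boxTerms onSphere) listed allSurvivors distinct)
      where
      onSphere : List (Vec Box N)
      onSphere = filter (λ v → norm v ≟ ρ) vs
      listed : ∀ {τ} → τ ∈ List.map boxTerms onSphere → Sphere at τ ≢ 0
      listed τ∈ with ∈-map⁻ boxTerms τ∈
      ... | v , v∈ , refl = boxTerm-kept v (proj₂ (∈-filter⁻ (λ v → norm v ≟ ρ) {xs = vs} v∈))
      allSurvivors : ∀ x y z → Sphere x y z ≢ 0 → (x , y , z) ∈ List.map boxTerms onSphere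
      allSurvivors x y z nz with surviving x y z nz
      ... | v , ‖v‖≡ρ , refl = ∈-map⁺ boxTerms (∈-filter⁺ (λ v → norm v ≟ ρ) (complete v) ‖v‖≡ρ)
      distinct : AllPairs Distinct (List.map boxTerms onSphere)
      distinct = AllPairs.map⁺ (AllPairs.map boxTerms-distinct (Unique.filter⁺ (λ v → norm v ≟ ρ) unique))

  -- The most populated sphere (by pigeonhole over the (Q₁ R₁)^N box tuples,
  -- whose norms are below 1 + N (4Q)²) gives the zeroing out.
  zeroesOut : ∀ N → Σ ℕ λ m → ZeroesOutInto (MM Q R Q ⊗^ N) m × (Q₁ * R₁) ^ N ≤ suc (N * (4 * Q * (4 * Q))) * m
  zeroesOut N =
    length (filter (λ v → norm v ≟ ρ) tuples) , (α , β , γ , independent tuples (listing-unique f) (listing-complete f)) ,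
    subst (_≤ K * length (filter (λ v → norm v ≟ ρ) tuples)) (length-listing f) (proj₂ pigeon)
    where
    K : ℕ
    K = suc (N * (4 * Q * (4 * Q)))
    f : Vec Box N ↔ Fin ((Q₁ * R₁) ^ N)
    f = tuples↔ Q₁ R₁ N
    tuples : List (Vec Box N)
    tuples = listing f
    pigeon : ∃ λ ρ → length tuples ≤ K * count norm tuples ρ
    pigeon = pigeonhole norm K tuples (s≤s z≤n) (λ {v} _ → s≤s (norm-bound v))
    ρ : ℕ
    ρ = proj₁ pigeon
    open OnSphere N ρ

^-distribʳ-* : ∀ m n k → (m * n) ^ k ≡ m ^ k * n ^ k
^-distribʳ-* m n zero    = refl
^-distribʳ-* m n (suc k) = trans (cong (m * n *_) (^-distribʳ-* m n k)) (interchange m n (m ^ k) (n ^ k))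
  where
  interchange : ∀ a b c d → a * b * (c * d) ≡ a * c * (b * d)
  interchange = solve-∀

1+n≤2^n : ∀ n → suc n ≤ 2 ^ n
1+n≤2^n zero    = ≤-refl
1+n≤2^n (suc n) = +-mono-≤ (≤-trans (s≤s z≤n) (1+n≤2^n n)) (≤-trans (1+n≤2^n n) (≤-reflexive (sym (+-identityʳ _))))

radii-bound : ∀ q N T → 2 ≤ q → suc (N * (4 * q ^ T * (4 * q ^ T))) ≤ q ^ (N + 4 + (T + T))
radii-bound q N T 2≤q = begin
  suc (N * (4 * Q * (4 * Q)))      ≤⟨ 1+N*c≤[1+N]*c N (4 * Q * (4 * Q)) 1≤16QQ ⟩
  suc N * (4 * Q * (4 * Q))        ≡⟨ cong (suc N *_) (sixteen Q) ⟩
  suc N * (2 ^ 4 * (Q * Q))        ≤⟨ *-mono-≤ (≤-trans (1+n≤2^n N) (^-monoˡ-≤ N 2≤q)) (*-monoˡ-≤ (Q * Q) (^-monoˡ-≤ 4 2≤q)) ⟩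
  q ^ N * (q ^ 4 * (Q * Q))        ≡⟨ cong (λ QQ → q ^ N * (q ^ 4 * QQ)) (sym (^-distribˡ-+-* q T T)) ⟩
  q ^ N * (q ^ 4 * q ^ (T + T))    ≡⟨ sym (trans (^-distribˡ-+-* q (N + 4) (T + T)) (trans (cong (_* q ^ (T + T)) (^-distribˡ-+-* q N 4)) (*-assoc (q ^ N) _ _))) ⟩
  q ^ (N + 4 + (T + T))            ∎
  where
  open ≤-Reasoning
  Q : ℕ
  Q = q ^ T
  instance _ : NonZero q
  _ = >-nonZero (≤-trans (s≤s z≤n) 2≤q)
  1≤16QQ : 1 ≤ 4 * Q * (4 * Q)
  1≤16QQ = *-mono-≤ (*-mono-≤ (s≤s (z≤n {3})) (m^n>0 q T)) (*-mono-≤ (s≤s (z≤n {3})) (m^n>0 q T))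
  1+N*c≤[1+N]*c : ∀ N c → 1 ≤ c → suc (N * c) ≤ suc N * c
  1+N*c≤[1+N]*c N c 1≤c = +-monoˡ-≤ (N * c) 1≤c
  sixteen : ∀ Q → 4 * Q * (4 * Q) ≡ 2 ^ 4 * (Q * Q)
  sixteen = solve-∀

-- Behrend's construction in N blocks of length T = t + 1, with the box
-- q^t × r^t inside ⟨q^T, r^T, q^T⟩, loses at most a factor q^(3N + 4 + 2T).
zeroesOut-blocks-bound : ∀ q r t N → 2 ≤ q → 1 ≤ r → r ≤ q →
  ∃ λ m → ZeroesOutInto (MM q r q ⊗^ (N * suc t)) m
        × (q ^ suc t * r ^ suc t) ^ N ≤ q ^ (N + N + (N + 4 + (suc t + suc t))) * m
zeroesOut-blocks-bound q r t N 2≤q 1≤r r≤q =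
  let (m , zo , box-bound) = Behrend.zeroesOut (q ^ suc t) (r ^ suc t) (q ^ t) (r ^ t) fits r^t≤r^T N in
  m , zeroesOut-blocks q r (suc t) N zo , (begin
    (q ^ suc t * r ^ suc t) ^ N       ≡⟨ cong (_^ N) (interchange q (q ^ t) r (r ^ t)) ⟩
    (q * r * (q ^ t * r ^ t)) ^ N     ≡⟨ ^-distribʳ-* (q * r) (q ^ t * r ^ t) N ⟩
    (q * r) ^ N * (q ^ t * r ^ t) ^ N ≤⟨ *-mono-≤ (^-monoˡ-≤ N (*-monoʳ-≤ q r≤q)) box-bound ⟩
    (q * q) ^ N * (K * m)             ≤⟨ *-monoʳ-≤ ((q * q) ^ N) (*-monoˡ-≤ m (radii-bound q N (suc t) 2≤q)) ⟩
    (q * q) ^ N * (q ^ L * m)         ≡⟨ cong (_* (q ^ L * m)) (trans (^-distribʳ-* q q N) (sym (^-distribˡ-+-* q N N))) ⟩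
    q ^ (N + N) * (q ^ L * m)         ≡⟨ sym (trans (cong (_* m) (^-distribˡ-+-* q (N + N) L)) (*-assoc (q ^ (N + N)) _ m)) ⟩
    q ^ (N + N + L) * m               ∎)
  where
  open ≤-Reasoning
  K : ℕ
  K = suc (N * (4 * q ^ suc t * (4 * q ^ suc t)))
  L : ℕ
  L = N + 4 + (suc t + suc t)
  instance _ : NonZero r
  _ = >-nonZero 1≤r
  interchange : ∀ q Q r R → q * Q * (r * R) ≡ q * r * (Q * R)
  interchange = solve-∀
  fits : q ^ t + r ^ t ≤ q ^ suc t
  fits = begin
    q ^ t + r ^ t       ≤⟨ +-monoʳ-≤ (q ^ t) (^-monoˡ-≤ t r≤q) ⟩
    q ^ t + q ^ t       ≡⟨ cong (q ^ t +_) (sym (+-identityʳ (q ^ t))) ⟩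
    2 * q ^ t           ≤⟨ *-monoˡ-≤ (q ^ t) 2≤q ⟩
    q ^ suc t           ∎
  r^t≤r^T : r ^ t ≤ r ^ suc t
  r^t≤r^T = m≤n*m (r ^ t) r

_≟ᵛ_ : ∀ {a b N} → DecidableEquality (Vec (Fin a × Fin b) N)
_≟ᵛ_ = Vec.≡-dec (Product.≡-dec _≟ᶠ_ _≟ᶠ_)

zeroesOut-MM-one : ∀ a b c s → Corner a b c → ZeroesOutInto (MM a b c ⊗^ s) 1
zeroesOut-MM-one a b c s c₀ =
  let (x , y , z) = mmTerms (replicate s c₀) in
  zeroesOut-single (MM a b c ⊗^ s) _≟ᵛ_ _≟ᵛ_ _≟ᵛ_ x y z
    (λ e → 1+n≢0 (trans (sym (MM⊗^-mmTerms (replicate s c₀))) e))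

-- For q ≥ 2 and 1 ≤ r ≤ q, the power n = s + N (t + 1) of ⟨q,r,q⟩ zeroes
-- out into m triples with (qr)^n ≤ q^(2s + 3N + 4 + 2(t+1)) m: one triple
-- for the first s coordinates, Behrend's construction on the N blocks.
zeroesOut-MM-bound : ∀ q r t s N → 2 ≤ q → 1 ≤ r → r ≤ q →
  ∃ λ m → ZeroesOutInto (MM q r q ⊗^ (s + N * suc t)) m
        × (q * r) ^ (s + N * suc t) ≤ q ^ (s + s + (N + N + (N + 4 + (suc t + suc t)))) * m
zeroesOut-MM-bound q r t s N 2≤q 1≤r r≤q =
  let (m , zo , bound) = zeroesOut-blocks-bound q r t N 2≤q 1≤r r≤q in
  m , subst (ZeroesOutInto (MM q r q ⊗^ (s + N * T))) (*-identityˡ m)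
            (zeroesOut-⊗^-+ (MM q r q) s (N * T) (zeroesOut-MM-one q r q s corner₀) zo) , (begin
    (q * r) ^ (s + N * T)               ≡⟨ ^-distribˡ-+-* (q * r) s (N * T) ⟩
    (q * r) ^ s * (q * r) ^ (N * T)     ≡⟨ cong ((q * r) ^ s *_) blocks ⟩
    (q * r) ^ s * (q ^ T * r ^ T) ^ N   ≤⟨ *-mono-≤ (^-monoˡ-≤ s (*-monoʳ-≤ q r≤q)) bound ⟩
    (q * q) ^ s * (q ^ L * m)           ≡⟨ cong (_* (q ^ L * m)) (trans (^-distribʳ-* q q s) (sym (^-distribˡ-+-* q s s))) ⟩
    q ^ (s + s) * (q ^ L * m)           ≡⟨ sym (trans (cong (_* m) (^-distribˡ-+-* q (s + s) L)) (*-assoc (q ^ (s + s)) _ m)) ⟩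
    q ^ (s + s + L) * m                 ∎)
  where
  open ≤-Reasoning
  T : ℕ
  T = suc t
  L : ℕ
  L = N + N + (N + 4 + (T + T))
  blocks : (q * r) ^ (N * T) ≡ (q ^ T * r ^ T) ^ N
  blocks = begin-equality
    (q * r) ^ (N * T)   ≡⟨ cong ((q * r) ^_) (*-comm N T) ⟩
    (q * r) ^ (T * N)   ≡⟨ sym (^-*-assoc (q * r) T N) ⟩
    ((q * r) ^ T) ^ N   ≡⟨ cong (_^ N) (^-distribʳ-* q r T) ⟩
    (q ^ T * r ^ T) ^ N ∎
  corner₀ : Corner q r q
  corner₀ = fromℕ< (≤-trans (s≤s z≤n) 2≤q) , fromℕ< 1≤r , fromℕ< (≤-trans (s≤s z≤n) 2≤q)

raise : ∀ q r n L m A B → 1 ≤ q → (q * r) ^ n ≤ q ^ L * m → L * B ≤ A * n →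
  (q * r) ^ (B * n) ≤ m ^ B * q ^ (A * n)
raise q r n L m A B 1≤q bound budget = begin
  (q * r) ^ (B * n)    ≡⟨ trans (cong ((q * r) ^_) (*-comm B n)) (sym (^-*-assoc (q * r) n B)) ⟩
  ((q * r) ^ n) ^ B    ≤⟨ ^-monoˡ-≤ B bound ⟩
  (q ^ L * m) ^ B      ≡⟨ trans (^-distribʳ-* (q ^ L) m B) (cong (_* m ^ B) (^-*-assoc q L B)) ⟩
  q ^ (L * B) * m ^ B  ≤⟨ *-monoˡ-≤ (m ^ B) (^-monoʳ-≤ q budget) ⟩
  q ^ (A * n) * m ^ B  ≡⟨ *-comm (q ^ (A * n)) (m ^ B) ⟩
  m ^ B * q ^ (A * n)  ∎
  where
  open ≤-Reasoning
  instance _ : NonZero q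
  _ = >-nonZero 1≤q

-- With blocks of length 8B and at least 8B + 1 of them, the loss exponent
-- times B fits into n.
budget : ∀ B s N → s < 8 * B → suc (8 * B) ≤ N →
  (s + s + (N + N + (N + 4 + (8 * B + 8 * B)))) * B ≤ s + N * (8 * B)
budget B s N s<T N≥ = begin
  (s + s + (N + N + (N + 4 + (T + T)))) * B        ≤⟨ *-monoˡ-≤ B (+-monoˡ-≤ _ (+-mono-≤ (<⇒≤ s<T) (<⇒≤ s<T))) ⟩
  (T + T + (N + N + (N + 4 + (T + T)))) * B        ≡⟨ cong (λ N → (T + T + (N + N + (N + 4 + (T + T)))) * B) (sym N≡) ⟩
  (T + T + (N₀ + N₀ + (N₀ + 4 + (T + T)))) * B     ≤⟨ m≤m+n _ _ ⟩
  _                                                 ≡⟨ identity B N′ ⟩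
  N₀ * T                                           ≡⟨ cong (_* T) N≡ ⟩
  N * T                                            ≤⟨ m≤n+m (N * T) s ⟩
  s + N * T                                        ∎
  where
  open ≤-Reasoning
  T : ℕ
  T = 8 * B
  N′ : ℕ
  N′ = N ∸ suc T
  N₀ : ℕ
  N₀ = suc T + N′
  N≡ : N₀ ≡ N
  N≡ = m+[n∸m]≡n N≥
  identity : ∀ B N′ → (8 * B + 8 * B + ((suc (8 * B) + N′) + (suc (8 * B) + N′) + ((suc (8 * B) + N′) + 4 + (8 * B + 8 * B)))) * B
                        + (8 * B * B + B + 5 * N′ * B) ≡ (suc (8 * B) + N′) * (8 * B)
  identity = solve-∀

-- For q ≥ 2, from n ≥ (8B + 1) 8B on: split n = s + N T with T = 8B
-- blocks, apply the block bound and raise it to the B-th power.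
zeroesOut-eventually : ∀ q r → 2 ≤ q → 1 ≤ r → r ≤ q → ∀ a b n → suc (8 * suc b) * (8 * suc b) ≤ n →
  Σ ℕ λ m → ZeroesOutInto (MM q r q ⊗^ n) m × m ^ suc b * q ^ (suc a * n) ≥ (q * r) ^ (suc b * n)
zeroesOut-eventually q r 2≤q 1≤r r≤q a b n n≥ =
  let (m , zo , bound) = zeroesOut-MM-bound q r (b + 7 * suc b) s N 2≤q 1≤r r≤q in
  subst Goal (sym n≡s+N*T)
    (m , zo , raise q r (s + N * T) (s + s + (N + N + (N + 4 + (T + T)))) m (suc a) (suc b) (≤-trans (s≤s z≤n) 2≤q) bound
                    (≤-trans (budget (suc b) s N (m%n<n n T) N≥) (m≤n*m (s + N * T) (suc a))))
  where
  T : ℕ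
  T = 8 * suc b
  s : ℕ
  s = n % T
  N : ℕ
  N = n / T
  n≡s+N*T : n ≡ s + N * T
  n≡s+N*T = m≡m%n+[m/n]*n n T
  N≥ : suc T ≤ N
  N≥ = ≤-trans (≤-reflexive (sym (m*n/n≡m (suc T) T))) (/-monoˡ-≤ T n≥)
  Goal : ℕ → Set
  Goal n = Σ ℕ λ m → ZeroesOutInto (MM q r q ⊗^ n) m × m ^ suc b * q ^ (suc a * n) ≥ (q * r) ^ (suc b * n)

-- q = 1 forces r = 1 and every power is a single term; for q ≥ 2 use the
-- eventual bound with threshold (8B + 1) 8B.
lemma5 : (q r : ℕ) → 1 ≤ q → 1 ≤ r → r ≤ q → (1 < q → 1 < r) →
    (a b : ℕ) → Σ ℕ λ N → (n : ℕ) → N ≤ n →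
      Σ ℕ λ m → ZeroesOutInto (MM q r q ⊗^ n) m
        × m ^ suc b * q ^ (suc a * n) ≥ (q * r) ^ (suc b * n)
lemma5 zero          _             ()  _   _       _ a b
lemma5 (suc zero)    zero          _   ()  _       _ a b
lemma5 (suc (suc _)) zero          _   ()  _       _ a b
lemma5 (suc zero)    (suc (suc _)) _   _   (s≤s ()) _ a b
lemma5 (suc zero) (suc zero) _ _ _ _ a b =
  0 , λ n _ → 1 , zeroesOut-MM-one 1 1 1 n (zero , zero , zero) ,
              raise 1 1 n 0 1 (suc a) (suc b) ≤-refl (≤-reflexive (^-zeroˡ n)) z≤n
lemma5 q@(suc (suc _)) r _ 1≤r r≤q _ a b =
  suc (8 * suc b) * (8 * suc b) , zeroesOut-eventually q r (s≤s (s≤s z≤n)) 1≤r r≤q a b
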